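{- Every $\mathcal L$-term is $\Sigma$-equivalent to an $m,u$-term; that is, for every $\mathcal L$-term $t$ there is an $m,u$-term $t'$ such that $\Sigma$ entails $t=t'$.
   Context: $\mathcal L$ is the language with one binary operation symbol $\cdot$ and two unary operation symbols $\ell$ and $r$. $\Sigma$ is the set of identities $\ell(x\cdot y)=x$, $r(x\cdot y)=y$, $\ell(z)\cdot r(z)=z$ (the axioms of Jónsson–Tarski algebras). $\mathcal L_m$ is the sublanguage consisting of $\cdot$ only, and $\mathcal L_u$ the sublanguage consisting of $\ell$ and $r$ only. An $m,u$-term is an $\mathcal L$-term of the form $w(u_1(x_{i_1}),\ldots,u_k(x_{i_k}))$ where $w(x_1,\ldots,x_k)$ is an $\mathcal L_m$-term and each $u_j(x_{i_j})$ is an $\mathcal L_u$-term (in a single variable). -}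

module Defs where

open import Data.Nat using (ℕ)
open import Data.Product using (Σ; _×_)

data Term : Set where
  var : ℕ → Term
  _·_ : Term → Term → Term
  ℓ   : Term → Term
  r   : Term → Term

infixl 7 _·_

Subst : Set
Subst = ℕ → Term

_[_] : Term → Subst → Term
var i   [ σ ] = σ i
(s · t) [ σ ] = (s [ σ ]) · (t [ σ ])
ℓ t     [ σ ] = ℓ (t [ σ ])
r t     [ σ ] = r (t [ σ ])

-- the identities of Σ (with x = var 0, y = var 1, z = var 2)
data Axiom : Term → Term → Set where
  ax-ℓ  : Axiom (ℓ (var 0 · var 1)) (var 0)
  ax-r  : Axiom (r (var 0 · var 1)) (var 1)
  ax-ℓr : Axiom (ℓ (var 2) · r (var 2)) (var 2)

infix 4 Σ⊢_≈_
data Σ⊢_≈_ : Term → Term → Set where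
  ax    : ∀ {s t} → Axiom s t → (σ : Subst) → Σ⊢ s [ σ ] ≈ t [ σ ]
  refl  : ∀ {t} → Σ⊢ t ≈ t
  sym   : ∀ {s t} → Σ⊢ s ≈ t → Σ⊢ t ≈ s
  trans : ∀ {s t u} → Σ⊢ s ≈ t → Σ⊢ t ≈ u → Σ⊢ s ≈ u
  cong· : ∀ {s s' t t'} → Σ⊢ s ≈ s' → Σ⊢ t ≈ t' → Σ⊢ s · t ≈ s' · t'
  congℓ : ∀ {s s'} → Σ⊢ s ≈ s' → Σ⊢ ℓ s ≈ ℓ s'
  congr : ∀ {s s'} → Σ⊢ s ≈ s' → Σ⊢ r s ≈ r s'

data IsUTerm : Term → Set where
  u-var : ∀ i → IsUTerm (var i)
  u-ℓ   : ∀ {t} → IsUTerm t → IsUTerm (ℓ t)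
  u-r   : ∀ {t} → IsUTerm t → IsUTerm (r t)

-- m,u-terms: w(u_1(x_{i_1}),...,u_k(x_{i_k})) with w an L_m-term,
-- i.e. a ·-tree whose leaves are L_u-terms in a single variable
data IsMUTerm : Term → Set where
  mu-leaf : ∀ {t} → IsUTerm t → IsMUTerm t
  mu-·    : ∀ {s t} → IsMUTerm s → IsMUTerm t → IsMUTerm (s · t)

-- Call a term t *m,u-representable* if Σ ⊢ t = t' for some m,u-term t'.
-- We show that the representable terms contain the variables and are closed
-- under the three operations; the theorem then follows by structural
-- induction on t.
--
--  * Variables and products are immediate: a variable is an L_u-term, and
--    a product of m,u-terms is again an m,u-term (cong· transports Σ-proofs).
--  * For ℓ (and symmetrically r) we first replace the argument by its
--    m,u-form t'. If t' is an L_u-leaf u(x_i), then ℓ t' is still such a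
--    leaf; if t' = a · b, the axiom ℓ(x · y) = x, instantiated at x := a,
--    y := b, rewrites ℓ t' to the m,u-term a.
module Submission where

open import Defs
open import Data.Product using (Σ; _×_; _,_)
open import Data.Nat using (zero; suc)

MURepresentable : Term → Set
MURepresentable t = Σ Term (λ t' → IsMUTerm t' × (Σ⊢ t ≈ t'))

transport : ∀ {s t} → Σ⊢ s ≈ t → MURepresentable t → MURepresentable s
transport s≈t (t' , mt' , t≈t') = t' , mt' , trans s≈t t≈t'

_↦_ : Term → Term → Subst
(a ↦ b) zero    = a
(a ↦ b) (suc _) = b

ℓ-pair : ∀ a b → Σ⊢ ℓ (a · b) ≈ a
ℓ-pair a b = ax ax-ℓ (a ↦ b)

r-pair : ∀ a b → Σ⊢ r (a · b) ≈ b
r-pair a b = ax ax-r (a ↦ b)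

ℓ-of-MUTerm : ∀ {t} → IsMUTerm t → MURepresentable (ℓ t)
ℓ-of-MUTerm {t}     (mu-leaf u)  = ℓ t , mu-leaf (u-ℓ u) , refl
ℓ-of-MUTerm {a · b} (mu-· ma _) = a , ma , ℓ-pair a b

r-of-MUTerm : ∀ {t} → IsMUTerm t → MURepresentable (r t)
r-of-MUTerm {t}     (mu-leaf u)  = r t , mu-leaf (u-r u) , refl
r-of-MUTerm {a · b} (mu-· _ mb) = b , mb , r-pair a b

var-representable : ∀ i → MURepresentable (var i)
var-representable i = var i , mu-leaf (u-var i) , refl

·-representable : ∀ {s t} → MURepresentable s → MURepresentable t → MURepresentable (s · t)
·-representable (s' , ms' , s≈s') (t' , mt' , t≈t') = s' · t' , mu-· ms' mt' , cong· s≈s' t≈t'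

ℓ-representable : ∀ {t} → MURepresentable t → MURepresentable (ℓ t)
ℓ-representable (t' , mt' , t≈t') = transport (congℓ t≈t') (ℓ-of-MUTerm mt')

r-representable : ∀ {t} → MURepresentable t → MURepresentable (r t)
r-representable (t' , mt' , t≈t') = transport (congr t≈t') (r-of-MUTerm mt')

lemma3p1 : (t : Term) → Σ Term (λ t' → IsMUTerm t' × (Σ⊢ t ≈ t'))
lemma3p1 (var i) = var-representable i
lemma3p1 (s · t) = ·-representable (lemma3p1 s) (lemma3p1 t)
lemma3p1 (ℓ t)   = ℓ-representable (lemma3p1 t)
lemma3p1 (r t)   = r-representable (lemma3p1 t)
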